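{- Let $G=(V,E)$ be a graph with $V=\{v_1,\dots,v_n\}$ and $E=\{e_1,\dots,e_m\}$, let $k$ be a positive integer, and let $G'$ be the ONE-ONE-LQ instance constructed from $(G,k)$ as in the context. Then $G$ has an independent set of size $k$ if and only if $G'$ has a feasible, envy-free matching of size $m+n$.
   Context: ONE-ONE-LQ instance: bipartite graph of agents and resources, each vertex with a strict preference list over its neighbours ($\succ_u$), each resource with upper-quota $1$ and lower-quota in $\{0,1\}$ (LQ resource if lower-quota $1$). Matching: each vertex in at most one edge; $M(v)$ partner or $\bot$ (least preferred). Feasible: every LQ resource matched. Envy: agent $a$ envies matched agent $a'$ with $M(a')=b$ if $a,b$ are mutually acceptable, $b\succ_a M(a)$ and $a\succ_b a'$; envy-free: no envy. Construction of $G'$: for each vertex $v_i$ there is a vertex-agent $a_i$; for each edge $e_j$ an edge-agent $a'_j$. Let $E_i$ be the set of edges incident to $v_i$, $\mathcal{E}_i$ the corresponding edge-agents, $q_i=|E_i|+1$. For each $v_i$ there is a set $B_i=\{b_i^1,\dots,b_i^{q_i}\}$ of resources with lower-quota $0$ and upper-quota $1$, and there is a set $X=\{x_1,\dots,x_k\}$ of resources with lower- and upper-quota $1$. Fix arbitrary orderings of $X$, each $B_i$ and each $\mathcal{E}_i$. Preference lists: $a_i$ lists the resources of $B_i$ (in the fixed order) followed by those of $X$; for $e_j=\{v_{j1},v_{j2}\}$, $a'_j$ lists the resources of $B_{j1}$ followed by those of $B_{j2}$; each $b_i^u$ lists $a_i$ followed by the agents of $\mathcal{E}_i$; each $x_j$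 lists $a_1,a_2,\dots,a_n$ in this order. -}

module Defs where

open import Data.Nat using (ℕ; suc; _+_; _≤_)
open import Data.Bool using (Bool; true; false)
open import Data.Fin using (Fin)
open import Data.Fin.Subset using (Subset; _∈_; ∣_∣)
open import Data.List using (List; []; _∷_; _++_; map; length; allFin)
open import Data.List.Membership.Propositional renaming (_∈_ to _∈ₗ_)
open import Data.List.Relation.Unary.Unique.Propositional using (Unique)
open import Data.Product using (Σ; ∃; _×_; _,_; proj₁; proj₂)
open import Data.Sum using (_⊎_; inj₁; inj₂)
open import Relation.Binary.PropositionalEquality using (_≡_; _≢_)
open import Relation.Nullary using (¬_)
open import Function.Bundles using (_⇔_)

-- Strict preferences given by preference lists.
-- `Before x y l` : x occurs strictly before y in the list l
-- (i.e. x is preferred to y when l is a preference list).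

data Before {A : Set} (x y : A) : List A → Set where
  here  : ∀ {z l} → x ≡ z → y ∈ₗ l → Before x y (z ∷ l)
  there : ∀ {z l} → Before x y l → Before x y (z ∷ l)

-- ONE-ONE-LQ instances (upper quota 1 everywhere; lq r = true means
-- lower quota 1, false means lower quota 0).

record Instance : Set₁ where
  field
    Agent : Set
    Res   : Set
    prefA : Agent → List Res     -- preference list of an agent (acceptable resources, best first)
    prefR : Res → List Agent
    lq    : Res → Bool

module _ (I : Instance) where
  open Instance I

  Acceptable : Agent → Res → Set
  Acceptable a r = (r ∈ₗ prefA a) × (a ∈ₗ prefR r)

  record IsMatching (M : List (Agent × Res)) : Set where
    field
      edges-ok    : ∀ {a r} → (a , r) ∈ₗ M → Acceptable a r
      agents-uniq : Unique (map proj₁ M)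
      res-uniq    : Unique (map proj₂ M)

  Unmatched : List (Agent × Res) → Agent → Set
  Unmatched M a = ∀ r → ¬ ((a , r) ∈ₗ M)

  PrefersToPartner : List (Agent × Res) → Agent → Res → Set
  PrefersToPartner M a b =
    Unmatched M a ⊎ (∃ λ r → ((a , r) ∈ₗ M) × Before b r (prefA a))

  Feasible : List (Agent × Res) → Set
  Feasible M = ∀ r → lq r ≡ true → ∃ λ a → (a , r) ∈ₗ M

  Envies : List (Agent × Res) → Agent → Agent → Set
  Envies M a a' = ∃ λ b → ((a' , b) ∈ₗ M) × Acceptable a b
                          × PrefersToPartner M a b × Before a a' (prefR b)

  EnvyFree : List (Agent × Res) → Set
  EnvyFree M = ∀ a a' → ¬ Envies M a a'

  HasFEFMatchingOfSize : ℕ → Set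
  HasFEFMatchingOfSize s =
    ∃ λ (M : List (Agent × Res)) →
      IsMatching M × Feasible M × EnvyFree M × length M ≡ s

SameEdge : ∀ {n} → Fin n × Fin n → Fin n × Fin n → Set
SameEdge (a , b) (c , d) = (a ≡ c × b ≡ d) ⊎ (a ≡ d × b ≡ c)

record Graph (n m : ℕ) : Set where
  field
    ends     : Fin m → Fin n × Fin n
    no-loops : ∀ j → proj₁ (ends j) ≢ proj₂ (ends j)
    simple   : ∀ j j' → SameEdge (ends j) (ends j') → j ≡ j'

module _ {n m : ℕ} (G : Graph n m) where
  open Graph G

  Incident : Fin n → Fin m → Set
  Incident i j = (proj₁ (ends j) ≡ i) ⊎ (proj₂ (ends j) ≡ i)

  HasIndependentSet : ℕ → Set
  HasIndependentSet k =
    ∃ λ (S : Subset n) → (∣ S ∣ ≡ k) ×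
      (∀ j → ¬ ((proj₁ (ends j) ∈ S) × (proj₂ (ends j) ∈ S)))

  IsOrderingOfE : Fin n → List (Fin m) → Set
  IsOrderingOfE i l = Unique l × (∀ j → (j ∈ₗ l) ⇔ Incident i j)

IsOrderingOfFin : (q : ℕ) → List (Fin q) → Set
IsOrderingOfFin q l = Unique l × (∀ u → u ∈ₗ l)

record Orderings {n m : ℕ} (G : Graph n m) (k : ℕ) : Set where
  field
    ordE   : (i : Fin n) → List (Fin m)
    ordE-ok : ∀ i → IsOrderingOfE G i (ordE i)
  q : Fin n → ℕ
  q i = suc (length (ordE i))
  field
    ordB   : (i : Fin n) → List (Fin (q i))
    ordB-ok : ∀ i → IsOrderingOfFin (q i) (ordB i)
    ordX   : List (Fin k)
    ordX-ok : IsOrderingOfFin k ordX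

-- The ONE-ONE-LQ instance G'.
-- Agents: inj₁ i = vertex-agent a_i, inj₂ j = edge-agent a'_j.
-- Resources: inj₁ (i , u) = b_i^u ∈ B_i, inj₂ x = x ∈ X.

module _ {n m k : ℕ} {G : Graph n m} (O : Orderings G k) where
  open Graph G
  open Orderings O

  G'Agent : Set
  G'Agent = Fin n ⊎ Fin m

  G'Res : Set
  G'Res = (Σ (Fin n) (λ i → Fin (q i))) ⊎ Fin k

  listB : Fin n → List G'Res
  listB i = map (λ u → inj₁ (i , u)) (ordB i)

  G'prefA : G'Agent → List G'Res
  G'prefA (inj₁ i) = listB i ++ map inj₂ ordX
  G'prefA (inj₂ j) = listB (proj₁ (ends j)) ++ listB (proj₂ (ends j))

  G'prefR : G'Res → List G'Agent
  G'prefR (inj₁ (i , u)) = inj₁ i ∷ map inj₂ (ordE i)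
  G'prefR (inj₂ x)       = map inj₁ (allFin n)

  G'lq : G'Res → Bool
  G'lq (inj₁ _) = false
  G'lq (inj₂ _) = true

  G' : Instance
  G' = record { Agent = G'Agent ; Res = G'Res ; prefA = G'prefA
              ; prefR = G'prefR ; lq = G'lq }

module Submission where

-- Given an independent set S of size k, match the vertex-agents of S to X, and for
-- every other vertex v_i match a_i, followed by the edge-agents of the edges assigned
-- to v_i, to B_i in order; every edge has an endpoint outside S to be assigned to, so
-- all m + n agents are matched. Inside each such block agents and resources rank each
-- other consistently with the zip order, so there is no envy within a block, and the
-- preference lists rule out envy across blocks. Conversely, a feasible envy-free
-- matching of size m + n matches every agent; the k vertices whose agents hold the
-- resources of X form an independent set, because the edge-agent of an edge between two
-- of them holds some b ∈ B_i, which ranks a_i first while a_i prefers b to its x ∈ X.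

open import Defs
open import Data.Nat using (ℕ; suc; _+_; _≤_; s≤s)
open import Data.Nat.Properties using (≤-reflexive; <-irrefl; +-comm; module ≤-Reasoning)
open import Data.Fin using (Fin; zero)
open import Data.Fin.Properties using (_≟_; +↔⊎)
open import Data.Fin.Subset using (Subset; _∈_; _∉_; ∣_∣; _-_; _─_; ⊤; ⁅_⁆; _∪_; inside; outside)
  renaming (⊥ to ∅)
open import Data.Fin.Subset.Properties
  using (_∈?_; p─⊥≡p; x∈p∧x≢y⇒x∈p-y; x∉⁅y⁆⇒x≢y; Empty-unique; ∣⊥∣≡0; ∣⊤∣≡n; ∣p∣≤n; ∈⊤; ∉⊥;
         x∈p∪q⁻; x∈p∪q⁺; x∈⁅x⁆; x∈⁅y⁆⇒x≡y)
open import Data.Vec using (_∷_; here; there)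
open import Data.List using (List; []; _∷_; _++_; map; length; zip; foldr; concatMap; allFin; filter)
open import Data.List.Properties using (length-map; map-++; length-tabulate; length-filter)
open import Data.List.Membership.Propositional using (find; lose) renaming (_∈_ to _∈ₗ_; _∉_ to _∉ₗ_)
open import Data.List.Membership.Propositional.Properties
  using (∈-map⁺; ∈-map⁻; ∈-++⁺ˡ; ∈-++⁺ʳ; ∈-++⁻; ∈-concatMap⁺; ∈-concatMap⁻; ∈-filter⁺; ∈-filter⁻; ∈-allFin)
import Data.List.Membership.DecPropositional as DecMembership
open import Data.List.Relation.Unary.Any using (here; there)
open import Data.List.Relation.Unary.Any.Properties using (¬Any[])
import Data.List.Relation.Unary.All as All
open import Data.List.Relation.Unary.All.Properties using (¬Any⇒All¬)
open import Data.List.Relation.Unary.Unique.Propositional using (Unique; []; _∷_)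
open import Data.List.Relation.Unary.Unique.Propositional.Properties using (Unique[x∷xs]⇒x∉xs; allFin⁺)
import Data.List.Relation.Unary.Unique.Propositional.Properties as Unique
open import Data.List.Relation.Binary.Disjoint.Propositional using (Disjoint)
open import Data.List.Relation.Binary.Sublist.Propositional using (_⊆_; _⊇_; []; _∷_; _∷ʳ_; ⊆-refl)
open import Data.List.Relation.Binary.Sublist.Propositional.Properties
  using (Any-resp-⊆; All-resp-⊆; []⊆-universal)
import Data.List.Relation.Binary.Sublist.Propositional.Properties as Sublist
open import Data.Product using (∃; _×_; _,_; proj₁; proj₂)
open import Data.Sum using (_⊎_; inj₁; inj₂)
open import Data.Sum.Properties using (inj₁-injective; inj₂-injective)
open import Data.Empty using (⊥-elim)
open import Function using (_↔_; _⇔_; mk⇔; Inverse; Equivalence; _∘_; id)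
open import Function.Construct.Identity using (↔-id)
open import Relation.Binary.Definitions using (_Respects_)
open import Relation.Binary.PropositionalEquality using (_≡_; _≢_; refl; sym; trans; cong; subst; module ≡-Reasoning)
open import Relation.Nullary using (¬_; ¬?; yes; no)

private variable
  A B C : Set
  x y z : A
  xs ys : List A

Before-∈ˡ : Before x y xs → x ∈ₗ xs
Before-∈ˡ (here refl _) = here refl
Before-∈ˡ (there x<y)   = there (Before-∈ˡ x<y)

Before-∈ʳ : Before x y xs → y ∈ₗ xs
Before-∈ʳ (here _ y∈xs) = there y∈xs
Before-∈ʳ (there x<y)   = there (Before-∈ʳ x<y)

Before-++ : x ∈ₗ xs → y ∈ₗ ys → Before x y (xs ++ ys)
Before-++ {xs = _ ∷ xs} (here x≡z) y∈ys = here x≡z (∈-++⁺ʳ xs y∈ys)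
Before-++ (there x∈xs)        y∈ys = there (Before-++ x∈xs y∈ys)

Before-irrefl : Unique xs → ¬ Before x x xs
Before-irrefl u       (here refl x∈xs) = Unique[x∷xs]⇒x∉xs u x∈xs
Before-irrefl (_ ∷ u) (there x<x)      = Before-irrefl u x<x

Before-asym : Unique xs → Before x y xs → ¬ Before y x xs
Before-asym u       (here refl y∈xs) (here refl _) = Unique[x∷xs]⇒x∉xs u y∈xs
Before-asym u       (here refl _)    (there y<x)   = Unique[x∷xs]⇒x∉xs u (Before-∈ʳ y<x)
Before-asym u       (there x<y)      (here refl _) = Unique[x∷xs]⇒x∉xs u (Before-∈ʳ x<y)
Before-asym (_ ∷ u) (there x<y)      (there y<x)   = Before-asym u x<y y<x

Before-trichotomy : x ∈ₗ xs → y ∈ₗ xs → x ≡ y ⊎ Before x y xs ⊎ Before y x xs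
Before-trichotomy (here x≡z)   (here y≡z)   = inj₁ (trans x≡z (sym y≡z))
Before-trichotomy (here x≡z)   (there y∈xs) = inj₂ (inj₁ (here x≡z y∈xs))
Before-trichotomy (there x∈xs) (here y≡z)   = inj₂ (inj₂ (here y≡z x∈xs))
Before-trichotomy (there x∈xs) (there y∈xs) with Before-trichotomy x∈xs y∈xs
... | inj₁ x≡y        = inj₁ x≡y
... | inj₂ (inj₁ x<y) = inj₂ (inj₁ (there x<y))
... | inj₂ (inj₂ y<x) = inj₂ (inj₂ (there y<x))

Before-mono-⊆ : xs ⊆ ys → Before x y xs → Before x y ys
Before-mono-⊆ (_ ∷ʳ σ)   x<y              = there (Before-mono-⊆ σ x<y)
Before-mono-⊆ (refl ∷ σ) (here x≡z y∈xs) = here x≡z (Any-resp-⊆ σ y∈xs)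
Before-mono-⊆ (refl ∷ σ) (there x<y)      = there (Before-mono-⊆ σ x<y)

Before-reflect-⊆ : Unique ys → xs ⊆ ys → x ∈ₗ xs → y ∈ₗ xs → Before x y ys → Before x y xs
Before-reflect-⊆ u σ x∈xs y∈xs x<y with Before-trichotomy x∈xs y∈xs
... | inj₁ refl        = ⊥-elim (Before-irrefl u x<y)
... | inj₂ (inj₁ x<y′) = x<y′
... | inj₂ (inj₂ y<x)  = ⊥-elim (Before-asym u x<y (Before-mono-⊆ σ y<x))

Unique-resp-⊇ : Unique {A = A} Respects _⊇_
Unique-resp-⊇ []         []        = []
Unique-resp-⊇ (_ ∷ʳ σ)   (_ ∷ u)   = Unique-resp-⊇ σ u
Unique-resp-⊇ (refl ∷ σ) (x∉ ∷ u) = All-resp-⊆ σ x∉ ∷ Unique-resp-⊇ σ u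

Unique-concatMap⁺ : {f : C → List A} {is : List C} → (∀ i → Unique (f i)) →
                    (∀ {i j} → i ≢ j → Disjoint (f i) (f j)) → Unique is → Unique (concatMap f is)
Unique-concatMap⁺ _ _ [] = []
Unique-concatMap⁺ {f = f} {is = i ∷ is} u disj (i∉is ∷ uis) =
  Unique.++⁺ (u i) (Unique-concatMap⁺ u disj uis) disjoint
  where
  disjoint : Disjoint (f i) (concatMap f is)
  disjoint (x∈fi , x∈rest) with find (∈-concatMap⁻ f {xs = is} x∈rest)
  ... | j , j∈is , x∈fj = disj (All.lookup i∉is j∈is) (x∈fi , x∈fj)

inj₁∉map-inj₂ : {ys : List B} → inj₁ {B = B} x ∉ₗ map inj₂ ys
inj₁∉map-inj₂ p with ∈-map⁻ inj₂ p
... | _ , _ , ()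

Unique-proj₁⇒functional : {ps : List (A × B)} → Unique (map proj₁ ps) →
                          (x , y) ∈ₗ ps → (x , z) ∈ₗ ps → y ≡ z
Unique-proj₁⇒functional u       (here refl) (here refl) = refl
Unique-proj₁⇒functional u       (here refl) (there q)   = ⊥-elim (Unique[x∷xs]⇒x∉xs u (∈-map⁺ proj₁ q))
Unique-proj₁⇒functional u       (there p)   (here refl) = ⊥-elim (Unique[x∷xs]⇒x∉xs u (∈-map⁺ proj₁ p))
Unique-proj₁⇒functional (_ ∷ u) (there p)   (there q)   = Unique-proj₁⇒functional u p q

map-proj₁-zip⊆ : (xs : List A) (ys : List B) → map proj₁ (zip xs ys) ⊆ xs
map-proj₁-zip⊆ []       _        = []
map-proj₁-zip⊆ (_ ∷ _)  []       = []⊆-universal _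
map-proj₁-zip⊆ (_ ∷ xs) (_ ∷ ys) = refl ∷ map-proj₁-zip⊆ xs ys

map-proj₂-zip⊆ : (xs : List A) (ys : List B) → map proj₂ (zip xs ys) ⊆ ys
map-proj₂-zip⊆ []       _        = []⊆-universal _
map-proj₂-zip⊆ (_ ∷ _)  []       = []
map-proj₂-zip⊆ (_ ∷ xs) (_ ∷ ys) = refl ∷ map-proj₂-zip⊆ xs ys

module _ (f : C → List A) (g : C → List B) where

  map-proj₁-concatMap-zip⊆ : ∀ is → map proj₁ (concatMap (λ i → zip (f i) (g i)) is) ⊆ concatMap f is
  map-proj₁-concatMap-zip⊆ []       = []
  map-proj₁-concatMap-zip⊆ (i ∷ is) = subst (_⊆ f i ++ concatMap f is) (sym (map-++ proj₁ (zip (f i) (g i)) _))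
    (Sublist.++⁺ (map-proj₁-zip⊆ (f i) (g i)) (map-proj₁-concatMap-zip⊆ is))

  map-proj₂-concatMap-zip⊆ : ∀ is → map proj₂ (concatMap (λ i → zip (f i) (g i)) is) ⊆ concatMap g is
  map-proj₂-concatMap-zip⊆ []       = []
  map-proj₂-concatMap-zip⊆ (i ∷ is) = subst (_⊆ g i ++ concatMap g is) (sym (map-++ proj₂ (zip (f i) (g i)) _))
    (Sublist.++⁺ (map-proj₂-zip⊆ (f i) (g i)) (map-proj₂-concatMap-zip⊆ is))

∈-zip⁻ : {xs : List A} {ys : List B} → (x , y) ∈ₗ zip xs ys → x ∈ₗ xs × y ∈ₗ ys
∈-zip⁻ {xs = xs} {ys} p =
  Any-resp-⊆ (map-proj₁-zip⊆ xs ys) (∈-map⁺ proj₁ p) , Any-resp-⊆ (map-proj₂-zip⊆ xs ys) (∈-map⁺ proj₂ p)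

∈-zip⁺ˡ : {xs : List A} {ys : List B} → length xs ≤ length ys → x ∈ₗ xs → ∃ λ y → (x , y) ∈ₗ zip xs ys
∈-zip⁺ˡ {ys = y ∷ _} _         (here refl)  = y , here refl
∈-zip⁺ˡ {ys = _ ∷ _} (s≤s len) (there x∈xs) = let y , p = ∈-zip⁺ˡ len x∈xs in y , there p

∈-zip⁺ʳ : {xs : List A} {ys : List B} → length ys ≤ length xs → y ∈ₗ ys → ∃ λ x → (x , y) ∈ₗ zip xs ys
∈-zip⁺ʳ {xs = x ∷ _} _         (here refl)  = x , here refl
∈-zip⁺ʳ {xs = _ ∷ _} (s≤s len) (there y∈ys) = let x , p = ∈-zip⁺ʳ len y∈ys in x , there p

zip-reflects-Before : {xs : List A} {ys : List B} {x x′ : A} {y y′ : B} → Unique ys →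
                      (x , y) ∈ₗ zip xs ys → (x′ , y′) ∈ₗ zip xs ys → Before y′ y ys → Before x′ x xs
zip-reflects-Before {xs = _ ∷ _} {_ ∷ _} u (here refl) _ (here _ y∈ys) = ⊥-elim (Unique[x∷xs]⇒x∉xs u y∈ys)
zip-reflects-Before {xs = _ ∷ _} {_ ∷ _} u (here refl) _ (there y′<y) =
  ⊥-elim (Unique[x∷xs]⇒x∉xs u (Before-∈ʳ y′<y))
zip-reflects-Before {xs = _ ∷ _} {_ ∷ _} _ (there p) (here refl) _ = here refl (proj₁ (∈-zip⁻ p))
zip-reflects-Before {xs = _ ∷ _} {_ ∷ _} u (there _) (there q) (here refl _) =
  ⊥-elim (Unique[x∷xs]⇒x∉xs u (proj₂ (∈-zip⁻ q)))
zip-reflects-Before {xs = _ ∷ _} {_ ∷ _} (_ ∷ u) (there p) (there q) (there y′<y) =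
  there (zip-reflects-Before u p q y′<y)

x∈p⇒∣p∣≡suc∣p-x∣ : ∀ {N} {x : Fin N} {p : Subset N} → x ∈ p → ∣ p ∣ ≡ suc ∣ p - x ∣
x∈p⇒∣p∣≡suc∣p-x∣ {p = inside ∷ p} here        = cong suc (cong ∣_∣ (sym (p─⊥≡p p)))
x∈p⇒∣p∣≡suc∣p-x∣ {p = outside ∷ _} (there x∈p) = x∈p⇒∣p∣≡suc∣p-x∣ x∈p
x∈p⇒∣p∣≡suc∣p-x∣ {p = inside ∷ _}  (there x∈p) = cong suc (x∈p⇒∣p∣≡suc∣p-x∣ x∈p)

x∈p─q⁻ : ∀ {N} {x : Fin N} {p q : Subset N} → x ∈ p ─ q → x ∈ p × x ∉ q
x∈p─q⁻ {p = inside ∷ _} {outside ∷ _} here = here , λ ()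
x∈p─q⁻ {x = zero} {_ ∷ _}       {inside ∷ _}  ()
x∈p─q⁻ {x = zero} {outside ∷ _} {outside ∷ _} ()
x∈p─q⁻ {p = _ ∷ _} {_ ∷ _} (there x∈p─q) with x∈p─q⁻ x∈p─q
... | x∈p , x∉q = there x∈p , λ { (there x∈q) → x∉q x∈q }

module _ {N : ℕ} where

  length≡∣p∣ : {p : Subset N} {l : List (Fin N)} → Unique l →
               (∀ {x} → x ∈ₗ l → x ∈ p) → (∀ {x} → x ∈ p → x ∈ₗ l) → length l ≡ ∣ p ∣
  length≡∣p∣ {l = []} _ _ from =
    sym (trans (cong ∣_∣ (Empty-unique λ { (_ , x∈p) → ¬Any[] (from x∈p) })) (∣⊥∣≡0 N))
  length≡∣p∣ {p = p} {l = x ∷ l} u@(_ ∷ u′) to from =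
    trans (cong suc (length≡∣p∣ u′ to′ from′)) (sym (x∈p⇒∣p∣≡suc∣p-x∣ (to (here refl))))
    where
    to′ : ∀ {y} → y ∈ₗ l → y ∈ p - x
    to′ y∈l = x∈p∧x≢y⇒x∈p-y (to (there y∈l)) λ { refl → Unique[x∷xs]⇒x∉xs u y∈l }
    from′ : ∀ {y} → y ∈ p - x → y ∈ₗ l
    from′ y∈p-x with x∈p─q⁻ y∈p-x
    ... | y∈p , y∉⁅x⁆ with from y∈p
    ...   | here refl = ⊥-elim (x∉⁅y⁆⇒x≢y y∉⁅x⁆ refl)
    ...   | there y∈l = y∈l

  fromList : List (Fin N) → Subset N
  fromList = foldr (λ x p → ⁅ x ⁆ ∪ p) ∅

  ∈-fromList⁺ : {x : Fin N} {l : List (Fin N)} → x ∈ₗ l → x ∈ fromList l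
  ∈-fromList⁺ (here refl) = x∈p∪q⁺ (inj₁ (x∈⁅x⁆ _))
  ∈-fromList⁺ (there x∈l) = x∈p∪q⁺ (inj₂ (∈-fromList⁺ x∈l))

  ∈-fromList⁻ : {x : Fin N} (l : List (Fin N)) → x ∈ fromList l → x ∈ₗ l
  ∈-fromList⁻ []      x∈∅ = ⊥-elim (∉⊥ x∈∅)
  ∈-fromList⁻ (y ∷ l) x∈ with x∈p∪q⁻ ⁅ y ⁆ (fromList l) x∈
  ... | inj₁ x∈⁅y⁆ = here (x∈⁅y⁆⇒x≡y y x∈⁅y⁆)
  ... | inj₂ x∈l   = there (∈-fromList⁻ l x∈l)

  ∣fromList∣≡length : {l : List (Fin N)} → Unique l → ∣ fromList l ∣ ≡ length l
  ∣fromList∣≡length {l} u = sym (length≡∣p∣ u ∈-fromList⁺ (∈-fromList⁻ l))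

module _ {N : ℕ} (e : Fin N ↔ A) where
  open Inverse e using (to; from; strictlyInverseˡ; strictlyInverseʳ)
  open DecMembership (_≟_ {N}) using () renaming (_∈?_ to _∈ₗ?_)

  private
    from-injective : ∀ {a b} → from a ≡ from b → a ≡ b
    from-injective {a} {b} eq = trans (sym (strictlyInverseˡ a)) (trans (cong to eq) (strictlyInverseˡ b))

  length≤ : {l : List A} → Unique l → length l ≤ N
  length≤ {l} u = begin
    length l                  ≡⟨ length-map from l ⟨
    length (map from l)       ≡⟨ ∣fromList∣≡length (Unique.map⁺ from-injective u) ⟨
    ∣ fromList (map from l) ∣ ≤⟨ ∣p∣≤n (fromList (map from l)) ⟩
    N                         ∎
    where open ≤-Reasoning

  complete⇒length≡ : {l : List A} → Unique l → (∀ a → a ∈ₗ l) → length l ≡ N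
  complete⇒length≡ {l} u complete = begin
    length l            ≡⟨ length-map from l ⟨
    length (map from l) ≡⟨ length≡∣p∣ {p = ⊤ {N}} (Unique.map⁺ from-injective u) (λ _ → ∈⊤) from-complete ⟩
    ∣ ⊤ {N} ∣           ≡⟨ ∣⊤∣≡n N ⟩
    N                   ∎
    where
    open ≡-Reasoning
    from-complete : ∀ {x} → x ∈ ⊤ {N} → x ∈ₗ map from l
    from-complete {x} _ = subst (_∈ₗ map from l) (strictlyInverseʳ x) (∈-map⁺ from (complete (to x)))

  length≡⇒complete : {l : List A} → Unique l → length l ≡ N → ∀ a → a ∈ₗ l
  length≡⇒complete {l} u len a with from a ∈ₗ? map from l
  ... | yes fa∈ = let b , b∈l , fa≡fb = ∈-map⁻ from fa∈ in subst (_∈ₗ l) (from-injective (sym fa≡fb)) b∈l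
  ... | no fa∉  = ⊥-elim (<-irrefl refl (subst (_≤ N) (cong suc len) (length≤ {a ∷ l} (a∉l ∷ u))))
    where a∉l = ¬Any⇒All¬ l (λ a∈l → fa∉ (∈-map⁺ from a∈l))

module _ (I : Instance) where
  open Instance I

  -- Zipping aligned lists is serial dictatorship in which everyone agrees on the order.
  record Aligned (as : List Agent) (rs : List Res) : Set where
    field
      res⊆prefA    : ∀ {a} → a ∈ₗ as → rs ⊆ prefA a
      agents⊆prefR : ∀ {r} → r ∈ₗ rs → as ⊆ prefR r
  open Aligned

  zip-acceptable : ∀ {as rs a r} → Aligned as rs → (a , r) ∈ₗ zip as rs → Acceptable I a r
  zip-acceptable al ar = let a∈as , r∈rs = ∈-zip⁻ ar in
    Any-resp-⊆ (res⊆prefA al a∈as) r∈rs , Any-resp-⊆ (agents⊆prefR al r∈rs) a∈as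

  module _ (prefA-unique : ∀ a → Unique (prefA a)) (prefR-unique : ∀ r → Unique (prefR r)) where

    zip-envy-free : ∀ {as rs a a′ r b} → Aligned as rs → (a , r) ∈ₗ zip as rs → (a′ , b) ∈ₗ zip as rs →
                    Before b r (prefA a) → ¬ Before a a′ (prefR b)
    zip-envy-free al ar a′b b<r a<a′ =
      Before-asym (prefR-unique _) a<a′ (Before-mono-⊆ (agents⊆prefR al b∈rs) a′<a)
      where
      a∈as = proj₁ (∈-zip⁻ ar)
      r∈rs = proj₂ (∈-zip⁻ ar)
      b∈rs = proj₂ (∈-zip⁻ a′b)
      rs⊆prefA = res⊆prefA al a∈as
      b<r-in-rs = Before-reflect-⊆ (prefA-unique _) rs⊆prefA b∈rs r∈rs b<r
      a′<a = zip-reflects-Before (Unique-resp-⊇ rs⊆prefA (prefA-unique _)) ar a′b b<r-in-rs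

module Reduction {n m k : ℕ} {G : Graph n m} (O : Orderings G k) where
  open Graph G
  open Orderings O

  length-ordX : length ordX ≡ k
  length-ordX = complete⇒length≡ (↔-id _) (proj₁ ordX-ok) (proj₂ ordX-ok)

  length-listB : ∀ i → length (listB O i) ≡ q i
  length-listB i =
    trans (length-map _ (ordB i)) (complete⇒length≡ (↔-id _) (proj₁ (ordB-ok i)) (proj₂ (ordB-ok i)))

  ∈-ordE⁻ : ∀ {i j} → j ∈ₗ ordE i → Incident G i j
  ∈-ordE⁻ {i} {j} = Equivalence.to (proj₂ (ordE-ok i) j)

  ∈-ordE⁺ : ∀ {i j} → Incident G i j → j ∈ₗ ordE i
  ∈-ordE⁺ {i} {j} = Equivalence.from (proj₂ (ordE-ok i) j)

  ∈-listB⁻ : ∀ {i r} → r ∈ₗ listB O i → ∃ λ u → r ≡ inj₁ (i , u)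
  ∈-listB⁻ r∈ = let u , _ , r≡ = ∈-map⁻ _ r∈ in u , r≡

  ∈-listB⁺ : ∀ {i} u → inj₁ (i , u) ∈ₗ listB O i
  ∈-listB⁺ {i} u = ∈-map⁺ _ (proj₂ (ordB-ok i) u)

  listB-unique : ∀ i → Unique (listB O i)
  listB-unique i = Unique.map⁺ (λ { refl → refl }) (proj₁ (ordB-ok i))

  listB-disjoint : ∀ {i i′} → i ≢ i′ → Disjoint (listB O i) (listB O i′)
  listB-disjoint i≢i′ (r∈ , r∈′) with ∈-listB⁻ r∈ | ∈-listB⁻ r∈′
  ... | _ , refl | _ , refl = i≢i′ refl

  listB-disjoint-X : ∀ {i} → Disjoint (listB O i) (map inj₂ ordX)
  listB-disjoint-X (r∈B , r∈X) with ∈-listB⁻ r∈B | ∈-map⁻ inj₂ r∈X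
  ... | _ , refl | _ , _ , ()

  prefA-unique : ∀ a → Unique (G'prefA O a)
  prefA-unique (inj₁ i) = Unique.++⁺ (listB-unique i) (Unique.map⁺ inj₂-injective (proj₁ ordX-ok)) listB-disjoint-X
  prefA-unique (inj₂ j) = Unique.++⁺ (listB-unique _) (listB-unique _) (listB-disjoint (no-loops j))

  prefR-unique : ∀ r → Unique (G'prefR O r)
  prefR-unique (inj₁ (i , _)) = ¬Any⇒All¬ _ inj₁∉map-inj₂ ∷ Unique.map⁺ inj₂-injective (proj₁ (ordE-ok i))
  prefR-unique (inj₂ _) = Unique.map⁺ inj₁-injective (allFin⁺ n)

  ∈-prefR-listB : ∀ {i r a} → r ∈ₗ listB O i → a ∈ₗ G'prefR O r →
                  a ≡ inj₁ i ⊎ ∃ λ j → a ≡ inj₂ j × Incident G i j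
  ∈-prefR-listB r∈ a∈ with ∈-listB⁻ r∈
  ∈-prefR-listB r∈ (here a≡) | _ , refl = inj₁ a≡
  ∈-prefR-listB r∈ (there a∈) | _ , refl = let j , j∈ , a≡ = ∈-map⁻ inj₂ a∈ in inj₂ (j , a≡ , ∈-ordE⁻ j∈)

  listB⊆prefA : ∀ {i j} → Incident G i j → listB O i ⊆ G'prefA O (inj₂ j)
  listB⊆prefA (inj₁ refl) = Sublist.++⁺ʳ _ ⊆-refl
  listB⊆prefA (inj₂ refl) = Sublist.++⁺ˡ _ ⊆-refl

  module FromIndependentSet (S : Subset n) (∣S∣≡k : ∣ S ∣ ≡ k)
                            (independent : ∀ j → ¬ (proj₁ (ends j) ∈ S × proj₂ (ends j) ∈ S)) where

    members : List (Fin n)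
    members = filter (_∈? S) (allFin n)

    outsiders : List (Fin n)
    outsiders = filter (λ i → ¬? (i ∈? S)) (allFin n)

    ∈-members⁻ : ∀ {i} → i ∈ₗ members → i ∈ S
    ∈-members⁻ = proj₂ ∘ ∈-filter⁻ (_∈? S) {xs = allFin n}

    length-members : length members ≡ k
    length-members = trans (length≡∣p∣ (Unique.filter⁺ (_∈? S) (allFin⁺ n)) ∈-members⁻
                                       (∈-filter⁺ (_∈? S) (∈-allFin _))) ∣S∣≡k

    host : Fin m → Fin n
    host j with proj₁ (ends j) ∈? S
    ... | yes _ = proj₂ (ends j)
    ... | no _  = proj₁ (ends j)

    host-∉ : ∀ j → host j ∉ S
    host-∉ j with proj₁ (ends j) ∈? S
    ... | yes e₁∈S = λ e₂∈S → independent j (e₁∈S , e₂∈S)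
    ... | no e₁∉S  = e₁∉S

    host-incident : ∀ j → Incident G (host j) j
    host-incident j with proj₁ (ends j) ∈? S
    ... | yes _ = inj₂ refl
    ... | no _  = inj₁ refl

    host-ends : ∀ {i j} → Incident G i j → i ∉ S → host j ≢ i → proj₁ (ends j) ≡ host j × proj₂ (ends j) ≡ i
    host-ends {j = j} inc i∉S host≢i with proj₁ (ends j) ∈? S | inc
    ... | yes e₁∈S | inj₁ refl = ⊥-elim (i∉S e₁∈S)
    ... | yes _    | inj₂ refl = ⊥-elim (host≢i refl)
    ... | no _     | inj₁ refl = ⊥-elim (host≢i refl)
    ... | no _     | inj₂ refl = refl , refl

    guests : Fin n → List (Fin m)
    guests i = filter (λ j → host j ≟ i) (ordE i)

    team : Fin n → List (G'Agent O)
    team i = inj₁ i ∷ map inj₂ (guests i)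

    owner : G'Agent O → Fin n
    owner (inj₁ i) = i
    owner (inj₂ j) = host j

    ∈-team⁻ : ∀ {i a} → a ∈ₗ team i → owner a ≡ i
    ∈-team⁻ (here refl) = refl
    ∈-team⁻ {i} (there a∈) with ∈-map⁻ inj₂ a∈
    ... | j , j∈ , refl = proj₂ (∈-filter⁻ (λ j → host j ≟ i) {xs = ordE i} j∈)

    team-unique : ∀ i → Unique (team i)
    team-unique i = ¬Any⇒All¬ _ inj₁∉map-inj₂ ∷ Unique.map⁺ inj₂-injective (Unique.filter⁺ _ (proj₁ (ordE-ok i)))

    length-team≤ : ∀ i → length (team i) ≤ length (listB O i)
    length-team≤ i = begin
      length (team i)              ≡⟨ cong suc (length-map inj₂ (guests i)) ⟩
      suc (length (guests i))      ≤⟨ s≤s (length-filter _ (ordE i)) ⟩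
      q i                          ≡⟨ length-listB i ⟨
      length (listB O i)           ∎
      where open ≤-Reasoning

    X-agents : List (G'Agent O)
    X-agents = map inj₁ members

    X-res : List (G'Res O)
    X-res = map inj₂ ordX

    X-block : List (G'Agent O × G'Res O)
    X-block = zip X-agents X-res

    block : Fin n → List (G'Agent O × G'Res O)
    block i = zip (team i) (listB O i)

    M : List (G'Agent O × G'Res O)
    M = X-block ++ concatMap block outsiders

    ∈M⁻ : ∀ {a r} → (a , r) ∈ₗ M → (a , r) ∈ₗ X-block ⊎ ∃ λ i → i ∉ S × (a , r) ∈ₗ block i
    ∈M⁻ p with ∈-++⁻ X-block p
    ... | inj₁ p∈X = inj₁ p∈X
    ... | inj₂ p∈B with find (∈-concatMap⁻ block {xs = outsiders} p∈B)
    ...   | i , i∈out , p∈Bi = inj₂ (i , proj₂ (∈-filter⁻ (λ i → ¬? (i ∈? S)) {xs = allFin n} i∈out) , p∈Bi)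

    ∈X-block⇒∈M : ∀ {a r} → (a , r) ∈ₗ X-block → (a , r) ∈ₗ M
    ∈X-block⇒∈M = ∈-++⁺ˡ

    ∈block⇒∈M : ∀ {i a r} → i ∉ S → (a , r) ∈ₗ block i → (a , r) ∈ₗ M
    ∈block⇒∈M {i} i∉S p = ∈-++⁺ʳ X-block (∈-concatMap⁺ block (lose (∈-filter⁺ (λ i → ¬? (i ∈? S)) (∈-allFin i) i∉S) p))

    X-block-aligned : Aligned (G' O) X-agents X-res
    X-block-aligned = record { res⊆prefA = res⊆prefA ; agents⊆prefR = agents⊆prefR }
      where
      res⊆prefA : ∀ {a} → a ∈ₗ X-agents → X-res ⊆ G'prefA O a
      res⊆prefA a∈ with ∈-map⁻ inj₁ a∈
      ... | i , _ , refl = Sublist.++⁺ˡ (listB O i) ⊆-refl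
      agents⊆prefR : ∀ {r} → r ∈ₗ X-res → X-agents ⊆ G'prefR O r
      agents⊆prefR r∈ with ∈-map⁻ inj₂ r∈
      ... | _ , _ , refl = Sublist.map⁺ inj₁ (Sublist.filter-⊆ (_∈? S) (allFin n))

    block-aligned : ∀ i → Aligned (G' O) (team i) (listB O i)
    block-aligned i = record { res⊆prefA = res⊆prefA ; agents⊆prefR = agents⊆prefR }
      where
      res⊆prefA : ∀ {a} → a ∈ₗ team i → listB O i ⊆ G'prefA O a
      res⊆prefA (here refl) = Sublist.++⁺ʳ _ ⊆-refl
      res⊆prefA (there a∈) with ∈-map⁻ inj₂ a∈
      ... | j , j∈ , refl = listB⊆prefA (subst (λ i → Incident G i j) (∈-team⁻ (there a∈)) (host-incident j))
      agents⊆prefR : ∀ {r} → r ∈ₗ listB O i → team i ⊆ G'prefR O r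
      agents⊆prefR r∈ with ∈-listB⁻ r∈
      ... | _ , refl = refl ∷ Sublist.map⁺ inj₂ (Sublist.filter-⊆ (λ j → host j ≟ i) (ordE i))

    X-block-lengths : length X-agents ≡ length X-res
    X-block-lengths = begin
      length X-agents ≡⟨ length-map inj₁ members ⟩
      length members  ≡⟨ length-members ⟩
      k               ≡⟨ length-ordX ⟨
      length ordX     ≡⟨ length-map inj₂ ordX ⟨
      length X-res    ∎
      where open ≡-Reasoning

    matched : ∀ a → ∃ λ r → (a , r) ∈ₗ M
    matched (inj₁ i) with i ∈? S
    ... | yes i∈S = let r , p = ∈-zip⁺ˡ (≤-reflexive X-block-lengths)
                                        (∈-map⁺ inj₁ (∈-filter⁺ (_∈? S) (∈-allFin i) i∈S))
                    in r , ∈X-block⇒∈M p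
    ... | no i∉S = let r , p = ∈-zip⁺ˡ (length-team≤ i) (here refl) in r , ∈block⇒∈M i∉S p
    matched (inj₂ j) = let r , p = ∈-zip⁺ˡ (length-team≤ (host j)) (there (∈-map⁺ inj₂ j∈guests))
                       in r , ∈block⇒∈M (host-∉ j) p
      where j∈guests = ∈-filter⁺ (λ j′ → host j′ ≟ host j) (∈-ordE⁺ (host-incident j)) refl

    feasible : Feasible (G' O) M
    feasible (inj₂ x) refl =
      let a , p = ∈-zip⁺ʳ (≤-reflexive (sym X-block-lengths)) (∈-map⁺ inj₂ (proj₂ ordX-ok x)) in a , ∈X-block⇒∈M p

    acceptable : ∀ {a r} → (a , r) ∈ₗ M → Acceptable (G' O) a r
    acceptable p with ∈M⁻ p
    ... | inj₁ p∈X = zip-acceptable (G' O) X-block-aligned p∈X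
    ... | inj₂ (i , _ , p∈Bi) = zip-acceptable (G' O) (block-aligned i) p∈Bi

    outsiders-unique : Unique outsiders
    outsiders-unique = Unique.filter⁺ _ (allFin⁺ n)

    agents-unique : Unique (map proj₁ M)
    agents-unique = Unique-resp-⊇ agents⊆roster roster-unique
      where
      agents⊆roster : map proj₁ M ⊆ X-agents ++ concatMap team outsiders
      agents⊆roster = subst (_⊆ X-agents ++ concatMap team outsiders) (sym (map-++ proj₁ X-block _))
        (Sublist.++⁺ (map-proj₁-zip⊆ X-agents X-res) (map-proj₁-concatMap-zip⊆ team (listB O) outsiders))
      teams-disjoint : ∀ {i i′} → i ≢ i′ → Disjoint (team i) (team i′)
      teams-disjoint i≢i′ (a∈ , a∈′) = i≢i′ (trans (sym (∈-team⁻ a∈)) (∈-team⁻ a∈′))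
      X-disjoint-teams : Disjoint X-agents (concatMap team outsiders)
      X-disjoint-teams (a∈X , a∈T) with ∈-map⁻ inj₁ a∈X | find (∈-concatMap⁻ team {xs = outsiders} a∈T)
      ... | i , i∈members , refl | i′ , i′∈outsiders , a∈team =
        proj₂ (∈-filter⁻ (λ i → ¬? (i ∈? S)) {xs = allFin n} i′∈outsiders)
              (subst (_∈ S) (∈-team⁻ a∈team) (∈-members⁻ i∈members))
      roster-unique : Unique (X-agents ++ concatMap team outsiders)
      roster-unique = Unique.++⁺ (Unique.map⁺ inj₁-injective (Unique.filter⁺ _ (allFin⁺ n)))
                                 (Unique-concatMap⁺ team-unique teams-disjoint outsiders-unique) X-disjoint-teams

    resources-unique : Unique (map proj₂ M)
    resources-unique = Unique-resp-⊇ resources⊆roster roster-unique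
      where
      resources⊆roster : map proj₂ M ⊆ X-res ++ concatMap (listB O) outsiders
      resources⊆roster = subst (_⊆ X-res ++ concatMap (listB O) outsiders) (sym (map-++ proj₂ X-block _))
        (Sublist.++⁺ (map-proj₂-zip⊆ X-agents X-res) (map-proj₂-concatMap-zip⊆ team (listB O) outsiders))
      X-disjoint-B : Disjoint X-res (concatMap (listB O) outsiders)
      X-disjoint-B (r∈X , r∈B) with find (∈-concatMap⁻ (listB O) {xs = outsiders} r∈B)
      ... | _ , _ , r∈Bi = listB-disjoint-X (r∈Bi , r∈X)
      roster-unique : Unique (X-res ++ concatMap (listB O) outsiders)
      roster-unique = Unique.++⁺ (Unique.map⁺ inj₂-injective (proj₁ ordX-ok))
                                 (Unique-concatMap⁺ listB-unique listB-disjoint outsiders-unique) X-disjoint-B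

    |M|≡m+n : length M ≡ m + n
    |M|≡m+n = begin
      length M              ≡⟨ length-map proj₁ M ⟨
      length (map proj₁ M)  ≡⟨ complete⇒length≡ +↔⊎ agents-unique (λ a → ∈-map⁺ proj₁ (proj₂ (matched a))) ⟩
      n + m                 ≡⟨ +-comm n m ⟩
      m + n                 ∎
      where open ≡-Reasoning

    block-agent-prefers-B-to-X : ∀ {i a r b} → (a , r) ∈ₗ block i → b ∈ₗ X-res → a ∈ₗ G'prefR O b →
                                 ¬ Before b r (G'prefA O a)
    block-agent-prefers-B-to-X ar∈Bi b∈X a∈ b<r with ∈-map⁻ inj₂ b∈X
    ... | _ , _ , refl with ∈-map⁻ inj₁ a∈
    ...   | i , _ , refl with ∈-team⁻ (proj₁ (∈-zip⁻ ar∈Bi))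
    ...     | refl = Before-asym (prefA-unique (inj₁ i)) b<r (Before-++ (proj₂ (∈-zip⁻ ar∈Bi)) b∈X)

    X-agent∉prefR-B : ∀ {i a r b} → i ∉ S → b ∈ₗ listB O i → (a , r) ∈ₗ X-block → a ∉ₗ G'prefR O b
    X-agent∉prefR-B i∉S b∈Bi ar∈X a∈ with ∈-map⁻ inj₁ (proj₁ (∈-zip⁻ ar∈X)) | ∈-prefR-listB b∈Bi a∈
    ... | _ , i∈members , refl | inj₁ refl = i∉S (∈-members⁻ i∈members)
    ... | _ , _ , refl | inj₂ (_ , () , _)

    cross-block-envy-free : ∀ {i i′ a r b} → i ≢ i′ → i′ ∉ S → (a , r) ∈ₗ block i → b ∈ₗ listB O i′ →
                            a ∈ₗ G'prefR O b → ¬ Before b r (G'prefA O a)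
    cross-block-envy-free i≢i′ i′∉S ar∈Bi b∈Bi′ a∈ b<r with ∈-zip⁻ ar∈Bi | ∈-prefR-listB b∈Bi′ a∈
    ... | a∈team , _    | inj₁ refl = i≢i′ (sym (∈-team⁻ a∈team))
    ... | a∈team , r∈Bi | inj₂ (j , refl , inc) with ∈-team⁻ a∈team
    ...   | refl with host-ends inc i′∉S i≢i′
    ...     | e₁ , e₂ = Before-asym (prefA-unique (inj₂ j)) b<r
                          (Before-++ (subst (λ v → _ ∈ₗ listB O v) (sym e₁) r∈Bi)
                                     (subst (λ v → _ ∈ₗ listB O v) (sym e₂) b∈Bi′))

    no-envy : ∀ {a a′ r b} → (a′ , b) ∈ₗ M → (a , r) ∈ₗ M → Before b r (G'prefA O a) → ¬ Before a a′ (G'prefR O b)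
    no-envy a′b ar b<r a<a′ with ∈M⁻ a′b | ∈M⁻ ar
    ... | inj₁ a′b∈X | inj₁ ar∈X =
      zip-envy-free (G' O) prefA-unique prefR-unique X-block-aligned ar∈X a′b∈X b<r a<a′
    ... | inj₁ a′b∈X | inj₂ (_ , _ , ar∈Bi) =
      block-agent-prefers-B-to-X ar∈Bi (proj₂ (∈-zip⁻ a′b∈X)) (Before-∈ˡ a<a′) b<r
    ... | inj₂ (_ , i′∉S , a′b∈Bi′) | inj₁ ar∈X =
      X-agent∉prefR-B i′∉S (proj₂ (∈-zip⁻ a′b∈Bi′)) ar∈X (Before-∈ˡ a<a′)
    ... | inj₂ (i′ , i′∉S , a′b∈Bi′) | inj₂ (i , _ , ar∈Bi) with i ≟ i′
    ...   | yes refl = zip-envy-free (G' O) prefA-unique prefR-unique (block-aligned i) ar∈Bi a′b∈Bi′ b<r a<a′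
    ...   | no i≢i′ = cross-block-envy-free i≢i′ i′∉S ar∈Bi (proj₂ (∈-zip⁻ a′b∈Bi′)) (Before-∈ˡ a<a′) b<r

    envy-free : EnvyFree (G' O) M
    envy-free a _ (_ , _ , _ , inj₁ unmatched , _) = unmatched _ (proj₂ (matched a))
    envy-free _ _ (_ , a′b , _ , inj₂ (_ , ar , b<r) , a<a′) = no-envy a′b ar b<r a<a′

    matching : HasFEFMatchingOfSize (G' O) (m + n)
    matching = M , record { edges-ok = acceptable ; agents-uniq = agents-unique ; res-uniq = resources-unique }
                 , feasible , envy-free , |M|≡m+n

  module FromMatching (M : List (G'Agent O × G'Res O)) (isM : IsMatching (G' O) M)
                      (feasible : Feasible (G' O) M) (envy-free : EnvyFree (G' O) M)
                      (|M|≡m+n : length M ≡ m + n) where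
    open IsMatching isM

    all-agents-matched : ∀ a → a ∈ₗ map proj₁ M
    all-agents-matched =
      length≡⇒complete +↔⊎ agents-uniq (trans (length-map proj₁ M) (trans |M|≡m+n (+-comm m n)))

    matched : ∀ a → ∃ λ r → (a , r) ∈ₗ M
    matched a with ∈-map⁻ proj₁ (all-agents-matched a)
    ... | (_ , r) , ar∈M , refl = r , ar∈M

    holder : ∀ x → ∃ λ i → (inj₁ i , inj₂ x) ∈ₗ M
    holder x with feasible (inj₂ x) refl
    ... | a , ax∈M with ∈-map⁻ inj₁ (proj₂ (edges-ok ax∈M))
    ...   | i , _ , refl = i , ax∈M

    holder-injective : ∀ {x y} → proj₁ (holder x) ≡ proj₁ (holder y) → x ≡ y
    holder-injective {x} {y} eq = inj₂-injective (Unique-proj₁⇒functional agents-uniq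
      (proj₂ (holder x)) (subst (λ i → (inj₁ i , inj₂ y) ∈ₗ M) (sym eq) (proj₂ (holder y))))

    holders : List (Fin n)
    holders = map (proj₁ ∘ holder) (allFin k)

    S : Subset n
    S = fromList holders

    ∣S∣≡k : ∣ S ∣ ≡ k
    ∣S∣≡k = begin
      ∣ S ∣                ≡⟨ ∣fromList∣≡length (Unique.map⁺ holder-injective (allFin⁺ k)) ⟩
      length holders       ≡⟨ length-map _ (allFin k) ⟩
      length (allFin k)    ≡⟨ length-tabulate id ⟩
      k                    ∎
      where open ≡-Reasoning

    ∈S⇒holds : ∀ {i} → i ∈ S → ∃ λ x → (inj₁ i , inj₂ x) ∈ₗ M
    ∈S⇒holds i∈S with ∈-map⁻ (proj₁ ∘ holder) (∈-fromList⁻ holders i∈S)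
    ... | x , _ , refl = x , proj₂ (holder x)

    vertex-envies-edge : ∀ {i j x u} → Incident G i j → (inj₁ i , inj₂ x) ∈ₗ M →
                         (inj₂ j , inj₁ (i , u)) ∈ₗ M → Envies (G' O) M (inj₁ i) (inj₂ j)
    vertex-envies-edge {x = x} {u} inc ix∈M ju∈M =
      inj₁ (_ , u) , ju∈M , (∈-++⁺ˡ (∈-listB⁺ u) , here refl) ,
      inj₂ (inj₂ x , ix∈M , Before-++ (∈-listB⁺ u) (∈-map⁺ inj₂ (proj₂ ordX-ok x))) ,
      here refl (∈-map⁺ inj₂ (∈-ordE⁺ inc))

    edge-agent∉B-of-S : ∀ {i j r} → Incident G i j → i ∈ S → r ∈ₗ listB O i → (inj₂ j , r) ∉ₗ M
    edge-agent∉B-of-S inc i∈S r∈B jr∈M with ∈-listB⁻ r∈B | ∈S⇒holds i∈S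
    ... | _ , refl | _ , ix∈M = envy-free _ _ (vertex-envies-edge inc ix∈M jr∈M)

    independent : ∀ j → ¬ (proj₁ (ends j) ∈ S × proj₂ (ends j) ∈ S)
    independent j (e₁∈S , e₂∈S) with matched (inj₂ j)
    ... | r , jr∈M with ∈-++⁻ (listB O (proj₁ (ends j))) (proj₁ (edges-ok jr∈M))
    ...   | inj₁ r∈B₁ = edge-agent∉B-of-S (inj₁ refl) e₁∈S r∈B₁ jr∈M
    ...   | inj₂ r∈B₂ = edge-agent∉B-of-S (inj₂ refl) e₂∈S r∈B₂ jr∈M

    independent-set : HasIndependentSet G k
    independent-set = S , ∣S∣≡k , independent

lemma9 : (n m : ℕ) (G : Graph n m) (k : ℕ) → 1 ≤ k → (O : Orderings G k) →
         HasIndependentSet G k ⇔ HasFEFMatchingOfSize (G' O) (m + n)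
lemma9 n m G k _ O = mk⇔    -- the construction also works for k = 0
  (λ (S , ∣S∣≡k , independent) → FromIndependentSet.matching S ∣S∣≡k independent)
  (λ (M , isM , feasible , envy-free , |M|) → FromMatching.independent-set M isM feasible envy-free |M|)
  where open Reduction O
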